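{- Let $k$ be a nonnegative integer and let $c$ be a radio labeling of $C_{2k+1}\square C_{2k+1}$. Then for any three vertices $u,v,w$ with $c(u)<c(v)<c(w)$, we have $c(w)-c(u)\ge k+1$.
   Context: $C_n$ is the cycle graph with vertex set $\{0,\dots,n-1\}$, distinct $v,w$ adjacent iff $v\equiv w\pm1 \pmod n$. The Cartesian product $G\square H$ has vertex set $V(G)\times V(H)$, with $(g,h)\sim(g',h')$ iff ($g=g'$ and $hh'\in E(H)$) or ($h=h'$ and $gg'\in E(G)$). $d(u,v)$ is graph distance and $\operatorname{diam}(G)$ the maximum distance in $G$. A radio labeling of a connected graph $G$ is a function $c:V(G)\to\{1,2,\dots\}$ with $d(u,v)+|c(u)-c(v)|\ge 1+\operatorname{diam}(G)$ for all distinct $u,v$. -}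

module Defs where

open import Data.Nat using (ℕ; zero; suc; _+_; _≤_; _<_; ∣_-_∣)
open import Data.Nat.DivMod using (_%_)
open import Data.Fin using (Fin; toℕ)
open import Data.Product using (_×_; _,_; Σ; ∃)
open import Data.Sum using (_⊎_)
open import Relation.Binary.PropositionalEquality using (_≡_)
open import Relation.Nullary using (¬_)

record Graph : Set₁ where
  field
    V   : Set
    Adj : V → V → Set
open Graph public

Cycle : (n : ℕ) → Graph
Cycle zero = record { V = Fin zero ; Adj = λ _ _ → Fin zero }
Cycle (suc m) = record
  { V = Fin (suc m)
  ; Adj = λ v w → ¬ (v ≡ w) ×
            ((toℕ v ≡ (toℕ w + 1) % suc m) ⊎ (toℕ w ≡ (toℕ v + 1) % suc m))
  }

_□_ : Graph → Graph → Graph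
G □ H = record
  { V = V G × V H
  ; Adj = λ { (g , h) (g' , h') →
              (g ≡ g' × Adj H h h') ⊎ (h ≡ h' × Adj G g g') }
  }

data Walk (G : Graph) : V G → V G → ℕ → Set where
  nil  : ∀ {u} → Walk G u u zero
  cons : ∀ {u v w m} → Adj G u v → Walk G v w m → Walk G u w (suc m)

IsDist : (G : Graph) → V G → V G → ℕ → Set
IsDist G u v m = Walk G u v m × (∀ m' → Walk G u v m' → m ≤ m')

IsDiam : (G : Graph) → ℕ → Set
IsDiam G D =
  (∀ u v → ∃ λ m → IsDist G u v m × m ≤ D) ×
  (Σ (V G) λ u → Σ (V G) λ v → IsDist G u v D)

IsRadioLabeling : (G : Graph) → (V G → ℕ) → Set
IsRadioLabeling G c =
  (∀ u → 1 ≤ c u) ×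
  (∀ D → IsDiam G D → ∀ u v → ¬ (u ≡ v) → ∀ m → IsDist G u v m →
     1 + D ≤ m + ∣ c u - c v ∣)

-- Write d for the graph distance of the torus T = C_{2k+1} □ C_{2k+1}; it is the sum of the
-- cycle distances of the two coordinates (that sum changes by at most one along an edge, so it
-- bounds every walk length from below), hence diam T = 2k.  On a cycle C_n the three pairwise
-- distances of any three vertices add up to at most n (the three arcs between them cover the
-- cycle), hence d u v + d v w + d u w ≤ 2(2k+1).  Adding the three radio conditions for
-- c u < c v < c w gives 3(2k+1) ≤ d u v + d v w + d u w + 2(c w − c u), so 2k+1 ≤ 2(c w − c u).
module Submission where

open import Data.Fin as Fin using (Fin; toℕ; fromℕ; fromℕ<)
open import Data.Fin.Properties using (toℕ-injective; toℕ<n; toℕ-fromℕ; toℕ-fromℕ<)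
open import Data.Nat
open import Data.Nat.DivMod using (_%_; n%n≡0; m<n⇒m%n≡m)
open import Data.Nat.Properties
open import Data.Nat.Solver using (module +-*-Solver)
open import Data.Product using (_×_; _,_; proj₁; proj₂)
open import Data.Sum using (inj₁; inj₂)
import Data.Sum as Sum
open import Function using (_∘_)
open import Relation.Binary.PropositionalEquality
open import Relation.Nullary using (¬_; yes; no; contradiction)

open import Defs

open +-*-Solver using (solve; _:+_; _:=_)

[n∸m]+[o∸n]≡o∸m : ∀ {m n o} → m ≤ n → n ≤ o → (n ∸ m) + (o ∸ n) ≡ o ∸ m
[n∸m]+[o∸n]≡o∸m {m} {n} {o} m≤n n≤o = begin
  (n ∸ m) + (o ∸ n)  ≡⟨ +-comm (n ∸ m) (o ∸ n) ⟩
  (o ∸ n) + (n ∸ m)  ≡⟨ +-∸-assoc (o ∸ n) m≤n ⟨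
  (o ∸ n) + n ∸ m    ≡⟨ cong (_∸ m) (m∸n+n≡m n≤o) ⟩
  o ∸ m              ∎
  where open ≡-Reasoning

[m∸y]+[1+x]≡1+m∸[y∸x] : ∀ {m x y} → x ≤ y → y ≤ m → (m ∸ y) + suc x ≡ suc m ∸ (y ∸ x)
[m∸y]+[1+x]≡1+m∸[y∸x] {m} {x} {y} x≤y y≤m = begin
  (m ∸ y) + suc x                        ≡⟨ m+n∸n≡m _ (y ∸ x) ⟨
  (m ∸ y) + suc x + (y ∸ x) ∸ (y ∸ x)    ≡⟨ cong (_∸ (y ∸ x)) around ⟩
  suc m ∸ (y ∸ x)                        ∎
  where
  open ≡-Reasoning
  around : (m ∸ y) + suc x + (y ∸ x) ≡ suc m
  around = begin
    (m ∸ y) + suc x + (y ∸ x)      ≡⟨ +-assoc (m ∸ y) (suc x) (y ∸ x) ⟩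
    (m ∸ y) + suc (x + (y ∸ x))    ≡⟨ cong (λ t → (m ∸ y) + suc t) (m+[n∸m]≡n x≤y) ⟩
    (m ∸ y) + suc y                ≡⟨ +-suc (m ∸ y) y ⟩
    suc ((m ∸ y) + y)              ≡⟨ cong suc (m∸n+n≡m y≤m) ⟩
    suc m                          ∎

∣m-n∣≤o : ∀ {m n o} → m ≤ o → n ≤ o → ∣ m - n ∣ ≤ o
∣m-n∣≤o {m} {n} m≤o n≤o = ≤-trans (∣m-n∣≤m⊔n m n) (⊔-lub m≤o n≤o)

WithinOne : ℕ → ℕ → Set
WithinOne x y = x ≤ suc y × y ≤ suc x

∣1+m-n∣-withinOne : ∀ m n → WithinOne ∣ suc m - n ∣ ∣ m - n ∣
∣1+m-n∣-withinOne m n =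
    ≤-trans (∣-∣-triangle (suc m) m n) (≤-reflexive (cong (_+ ∣ m - n ∣) ∣1+m-m∣≡1))
  , ≤-trans (∣-∣-triangle m (suc m) n)
            (≤-reflexive (cong (_+ ∣ suc m - n ∣) (trans (∣-∣-comm m (suc m)) ∣1+m-m∣≡1)))
  where
  ∣1+m-m∣≡1 : ∣ suc m - m ∣ ≡ 1
  ∣1+m-m∣≡1 = trans (m≤n⇒∣n-m∣≡n∸m (n≤1+n m)) (m+n∸n≡m 1 m)

three-gaps : ∀ {N d₁ d₂ d₃ x y z} → x + y ≡ z →
             N ≤ d₁ + x → N ≤ d₂ + y → N ≤ d₃ + z → d₁ + d₂ + d₃ ≤ N + N → N ≤ z + z
three-gaps {N} {d₁} {d₂} {d₃} {x} {y} refl h₁ h₂ h₃ perimeter = +-cancelˡ-≤ (N + N) N _ (begin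
  N + N + N                                   ≤⟨ +-mono-≤ (+-mono-≤ h₁ h₂) h₃ ⟩
  (d₁ + x) + (d₂ + y) + (d₃ + (x + y))        ≡⟨ rearrange ⟩
  (d₁ + d₂ + d₃) + ((x + y) + (x + y))        ≤⟨ +-monoˡ-≤ _ perimeter ⟩
  (N + N) + ((x + y) + (x + y))               ∎)
  where
  open ≤-Reasoning
  rearrange = solve 5 (λ d₁ d₂ d₃ x y →
    (d₁ :+ x) :+ (d₂ :+ y) :+ (d₃ :+ (x :+ y)) := (d₁ :+ d₂ :+ d₃) :+ ((x :+ y) :+ (x :+ y)))
    refl d₁ d₂ d₃ x y

2*k+1≡1+[k+k] : ∀ k → 2 * k + 1 ≡ suc (k + k)
2*k+1≡1+[k+k] k = trans (+-comm (2 * k) 1) (cong (suc ∘ (k +_)) (+-identityʳ k))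

1+2k≤2t⇒k+1≤t : ∀ {k t} → suc (k + k) ≤ t + t → k + 1 ≤ t
1+2k≤2t⇒k+1≤t {k} {t} 1+2k≤2t with k <? t
... | yes k<t = subst (_≤ t) (+-comm 1 k) k<t
... | no k≮t  = contradiction (≤-trans 1+2k≤2t (+-mono-≤ t≤k t≤k)) (1+n≰n {k + k})
  where t≤k = ≮⇒≥ k≮t

minArc : ℕ → ℕ → ℕ
minArc n d = d ⊓ (n ∸ d)

cycleDist : ℕ → ℕ → ℕ → ℕ
cycleDist n a b = minArc n ∣ a - b ∣

minArc≤d : ∀ n d → minArc n d ≤ d
minArc≤d n d = m⊓n≤m d (n ∸ d)

minArc≤n∸d : ∀ n d → minArc n d ≤ n ∸ d
minArc≤n∸d n d = m⊓n≤n d (n ∸ d)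

minArc-flip : ∀ {n d} → d ≤ n → minArc n (n ∸ d) ≡ minArc n d
minArc-flip {n} {d} d≤n rewrite m∸[m∸n]≡n d≤n = ⊓-comm (n ∸ d) d

minArc-≤-suc : ∀ {n d e} → d ≤ suc e → e ≤ suc d → e ≤ n → minArc n d ≤ suc (minArc n e)
minArc-≤-suc {n} {d} {e} d≤1+e e≤1+d e≤n = ⊓-mono-≤ d≤1+e (m≤n+o⇒m∸n≤o n d n≤d+[1+n∸e])
  where
  n≤d+[1+n∸e] : n ≤ d + suc (n ∸ e)
  n≤d+[1+n∸e] = begin
    n               ≤⟨ m≤n+m∸n n e ⟩
    e + (n ∸ e)     ≤⟨ +-monoˡ-≤ (n ∸ e) e≤1+d ⟩
    suc d + (n ∸ e) ≡⟨ +-suc d (n ∸ e) ⟨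
    d + suc (n ∸ e) ∎
    where open ≤-Reasoning

minArc-withinOne : ∀ {n d e} → WithinOne d e → d ≤ n → e ≤ n →
                   WithinOne (minArc n d) (minArc n e)
minArc-withinOne (d≤1+e , e≤1+d) d≤n e≤n =
  minArc-≤-suc d≤1+e e≤1+d e≤n , minArc-≤-suc e≤1+d d≤1+e d≤n

minArc-odd-≤ : ∀ k d → minArc (suc (k + k)) d ≤ k
minArc-odd-≤ k d with d ≤? k
... | yes d≤k = ≤-trans (minArc≤d _ d) d≤k
... | no d≰k  = ≤-trans (minArc≤n∸d _ d) (≤-trans (∸-monoʳ-≤ (suc (k + k)) (≰⇒> d≰k))
                                               (≤-reflexive (m+n∸m≡n k k)))

minArc-odd-half : ∀ k → minArc (suc (k + k)) k ≡ k
minArc-odd-half k rewrite m+n∸n≡m (suc k) k = m≤n⇒m⊓n≡m (n≤1+n k)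

cycleDist-comm : ∀ n a b → cycleDist n a b ≡ cycleDist n b a
cycleDist-comm n a b = cong (minArc n) (∣-∣-comm a b)

cycleDist-succ : ∀ {n b c} → suc b ≤ n → c ≤ n →
                 WithinOne (cycleDist n (suc b) c) (cycleDist n b c)
cycleDist-succ {b = b} {c} 1+b≤n c≤n =
  minArc-withinOne (∣1+m-n∣-withinOne b c) (∣m-n∣≤o 1+b≤n c≤n) (∣m-n∣≤o (<⇒≤ 1+b≤n) c≤n)

cycleDist-last : ∀ {m c} → c ≤ m → cycleDist (suc m) m c ≡ minArc (suc m) (suc c)
cycleDist-last {m} {c} c≤m = begin
  minArc (suc m) ∣ m - c ∣            ≡⟨ cong (minArc (suc m)) (m≤n⇒∣n-m∣≡n∸m c≤m) ⟩
  minArc (suc m) (m ∸ c)              ≡⟨ minArc-flip (m≤n⇒m≤1+n (m∸n≤m m c)) ⟨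
  minArc (suc m) (suc m ∸ (m ∸ c))    ≡⟨ cong (minArc (suc m)) (+-∸-assoc 1 (m∸n≤m m c)) ⟩
  minArc (suc m) (suc (m ∸ (m ∸ c)))  ≡⟨ cong (minArc (suc m) ∘ suc) (m∸[m∸n]≡n c≤m) ⟩
  minArc (suc m) (suc c)              ∎
  where open ≡-Reasoning

cycleDist-wrap : ∀ {m c} → c ≤ m → WithinOne (cycleDist (suc m) 0 c) (cycleDist (suc m) m c)
cycleDist-wrap c≤m rewrite cycleDist-last c≤m =
  minArc-withinOne (m≤n⇒m≤1+n (n≤1+n _) , ≤-refl) (m≤n⇒m≤1+n c≤m) (s≤s c≤m)

[a+1]%[1+m]≡1+a : ∀ {a m} → a < m → (a + 1) % suc m ≡ suc a
[a+1]%[1+m]≡1+a {a} {m} a<m = trans (cong (_% suc m) (+-comm a 1)) (m<n⇒m%n≡m (s≤s a<m))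

[m+1]%[1+m]≡0 : ∀ m → (m + 1) % suc m ≡ 0
[m+1]%[1+m]≡0 m = trans (cong (_% suc m) (+-comm m 1)) (n%n≡0 (suc m))

cycleDist-step : ∀ {m a b c} → b ≤ m → c ≤ m → a ≡ (b + 1) % suc m →
                 WithinOne (cycleDist (suc m) a c) (cycleDist (suc m) b c)
cycleDist-step b≤m c≤m a≡[b+1]%n with m≤n⇒m<n∨m≡n b≤m
... | inj₁ b<m with trans a≡[b+1]%n ([a+1]%[1+m]≡1+a b<m)
...   | refl = cycleDist-succ (m≤n⇒m≤1+n b<m) (m≤n⇒m≤1+n c≤m)
cycleDist-step {m} b≤m c≤m a≡[b+1]%n | inj₂ refl with trans a≡[b+1]%n ([m+1]%[1+m]≡0 m)
... | refl = cycleDist-wrap c≤m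

perimeter : ℕ → ℕ → ℕ → ℕ → ℕ
perimeter n a b c = cycleDist n a b + cycleDist n b c + cycleDist n a c

sorted-wlog : (P : ℕ → ℕ → ℕ → Set) →
              (∀ {a b c} → P a b c → P b a c) → (∀ {a b c} → P a b c → P a c b) →
              (∀ {a b c} → a ≤ b → b ≤ c → P a b c) → ∀ a b c → P a b c
sorted-wlog P swap₁₂ swap₂₃ sorted a b c with ≤-total a b | ≤-total b c | ≤-total a c
... | inj₁ a≤b | inj₁ b≤c | _        = sorted a≤b b≤c
... | inj₁ a≤b | inj₂ c≤b | inj₁ a≤c = swap₂₃ (sorted a≤c c≤b)
... | inj₁ a≤b | inj₂ c≤b | inj₂ c≤a = swap₂₃ (swap₁₂ (sorted c≤a a≤b))
... | inj₂ b≤a | _        | inj₁ a≤c = swap₁₂ (sorted b≤a a≤c)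
... | inj₂ b≤a | inj₁ b≤c | inj₂ c≤a = swap₁₂ (swap₂₃ (sorted b≤c c≤a))
... | inj₂ b≤a | inj₂ c≤b | _        = swap₁₂ (swap₂₃ (swap₁₂ (sorted c≤b b≤a)))

perimeter-swap₁₂ : ∀ n a b c → perimeter n b a c ≡ perimeter n a b c
perimeter-swap₁₂ n a b c rewrite cycleDist-comm n b a =
  solve 3 (λ x y z → x :+ y :+ z := x :+ z :+ y) refl
    (cycleDist n a b) (cycleDist n a c) (cycleDist n b c)

perimeter-swap₂₃ : ∀ n a b c → perimeter n a c b ≡ perimeter n a b c
perimeter-swap₂₃ n a b c rewrite cycleDist-comm n c b =
  solve 3 (λ x y z → x :+ y :+ z := z :+ y :+ x) refl
    (cycleDist n a c) (cycleDist n b c) (cycleDist n a b)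

perimeter-sorted : ∀ {n a b c} → a ≤ b → b ≤ c → c ≤ n → perimeter n a b c ≤ n
perimeter-sorted {n} {a} {b} {c} a≤b b≤c c≤n = begin
  cycleDist n a b + cycleDist n b c + cycleDist n a c
    ≤⟨ +-mono-≤ (+-mono-≤ (minArc≤d n ∣ a - b ∣) (minArc≤d n ∣ b - c ∣))
                (minArc≤n∸d n ∣ a - c ∣) ⟩
  ∣ a - b ∣ + ∣ b - c ∣ + (n ∸ ∣ a - c ∣)
    ≡⟨ cong₂ (λ x y → x + (n ∸ y)) arcs (m≤n⇒∣m-n∣≡n∸m a≤c) ⟩
  (c ∸ a) + (n ∸ (c ∸ a))
    ≡⟨ m+[n∸m]≡n (≤-trans (m∸n≤m c a) c≤n) ⟩
  n ∎
  where
  open ≤-Reasoning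
  a≤c = ≤-trans a≤b b≤c
  arcs : ∣ a - b ∣ + ∣ b - c ∣ ≡ c ∸ a
  arcs = trans (cong₂ _+_ (m≤n⇒∣m-n∣≡n∸m a≤b) (m≤n⇒∣m-n∣≡n∸m b≤c)) ([n∸m]+[o∸n]≡o∸m a≤b b≤c)

perimeter-≤ : ∀ {n a b c} → a ≤ n → b ≤ n → c ≤ n → perimeter n a b c ≤ n
perimeter-≤ {n} {a} {b} {c} = sorted-wlog Bounded swap₁₂ swap₂₃ sorted a b c
  where
  Bounded : ℕ → ℕ → ℕ → Set
  Bounded a b c = a ≤ n → b ≤ n → c ≤ n → perimeter n a b c ≤ n
  swap₁₂ : ∀ {a b c} → Bounded a b c → Bounded b a c
  swap₁₂ {a} {b} {c} bound b≤n a≤n c≤n =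
    subst (_≤ n) (sym (perimeter-swap₁₂ n a b c)) (bound a≤n b≤n c≤n)
  swap₂₃ : ∀ {a b c} → Bounded a b c → Bounded a c b
  swap₂₃ {a} {b} {c} bound a≤n c≤n b≤n =
    subst (_≤ n) (sym (perimeter-swap₂₃ n a b c)) (bound a≤n b≤n c≤n)
  sorted : ∀ {a b c} → a ≤ b → b ≤ c → Bounded a b c
  sorted a≤b b≤c _ _ c≤n = perimeter-sorted a≤b b≤c c≤n

Lipschitzˡ : (G : Graph) → (V G → V G → ℕ) → Set
Lipschitzˡ G φ = ∀ {u v} w → Adj G u v → φ u w ≤ suc (φ v w)

module _ {G : Graph} where

  _++ʷ_ : ∀ {u v w a b} → Walk G u v a → Walk G v w b → Walk G u w (a + b)
  nil      ++ʷ q = q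
  cons e p ++ʷ q = cons e (p ++ʷ q)

  reverseʷ : (∀ {u v} → Adj G u v → Adj G v u) → ∀ {u v l} → Walk G u v l → Walk G v u l
  reverseʷ adj-sym nil                = nil
  reverseʷ adj-sym (cons {m = l} e p) =
    subst (Walk G _ _) (+-comm l 1) (reverseʷ adj-sym p ++ʷ cons (adj-sym e) nil)

  Lipschitzˡ⇒≤length : ∀ {φ : V G → V G → ℕ} → (∀ u → φ u u ≡ 0) → Lipschitzˡ G φ →
                       ∀ {u v l} → Walk G u v l → φ u v ≤ l
  Lipschitzˡ⇒≤length φ-refl φ-lip {u} nil        = ≤-reflexive (φ-refl u)
  Lipschitzˡ⇒≤length φ-refl φ-lip {v = w} (cons e p) =
    ≤-trans (φ-lip w e) (s≤s (Lipschitzˡ⇒≤length φ-refl φ-lip p))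

  IsDist⇒refl : ∀ {φ : V G → V G → ℕ} → (∀ u v → IsDist G u v (φ u v)) → ∀ u → φ u u ≡ 0
  IsDist⇒refl dist u = n≤0⇒n≡0 (proj₂ (dist u u) 0 nil)

  IsDist⇒Lipschitzˡ : ∀ {φ : V G → V G → ℕ} → (∀ u v → IsDist G u v (φ u v)) → Lipschitzˡ G φ
  IsDist⇒Lipschitzˡ dist {u} {v} w e = proj₂ (dist u w) _ (cons e (proj₁ (dist v w)))

radio-gap : ∀ {G c D u v m} → IsRadioLabeling G c → IsDiam G D → IsDist G u v m →
            c u < c v → suc D ≤ m + (c v ∸ c u)
radio-gap {c = c} {D} {u} {v} {m} (_ , radio) diam u⇝v cu<cv =
  subst (λ t → suc D ≤ m + t) (m≤n⇒∣m-n∣≡n∸m (<⇒≤ cu<cv)) (radio D diam u v u≢v m u⇝v)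
  where
  u≢v : u ≢ v
  u≢v refl = <-irrefl refl cu<cv

module _ {G H : Graph} where

  liftˡ : ∀ {g g' l} (h : V H) → Walk G g g' l → Walk (G □ H) (g , h) (g' , h) l
  liftˡ h nil        = nil
  liftˡ h (cons e p) = cons (inj₂ (refl , e)) (liftˡ h p)

  liftʳ : ∀ {h h' l} (g : V G) → Walk H h h' l → Walk (G □ H) (g , h) (g , h') l
  liftʳ g nil        = nil
  liftʳ g (cons e p) = cons (inj₁ (refl , e)) (liftʳ g p)

  sumDist : (V G → V G → ℕ) → (V H → V H → ℕ) → V (G □ H) → V (G □ H) → ℕ
  sumDist φ ψ (g , h) (g' , h') = φ g g' + ψ h h'

  sumDist-Lipschitzˡ : ∀ {φ ψ} → Lipschitzˡ G φ → Lipschitzˡ H ψ →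
                       Lipschitzˡ (G □ H) (sumDist φ ψ)
  sumDist-Lipschitzˡ {φ} {ψ} φ-lip ψ-lip {g , h} {.g , _} (g' , h') (inj₁ (refl , e)) =
    ≤-trans (+-monoʳ-≤ (φ g g') (ψ-lip h' e)) (≤-reflexive (+-suc (φ g g') _))
  sumDist-Lipschitzˡ {φ} {ψ} φ-lip ψ-lip {g , h} {_ , .h} (g' , h') (inj₂ (refl , e)) =
    +-monoˡ-≤ (ψ h h') (φ-lip g' e)

  □-IsDist : ∀ {φ ψ} → (∀ g g' → IsDist G g g' (φ g g')) → (∀ h h' → IsDist H h h' (ψ h h')) →
             ∀ u v → IsDist (G □ H) u v (sumDist φ ψ u v)
  □-IsDist {φ} {ψ} φ-dist ψ-dist (g , h) (g' , h') =
      liftˡ h (proj₁ (φ-dist g g')) ++ʷ liftʳ g' (proj₁ (ψ-dist h h'))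
    , λ l p → Lipschitzˡ⇒≤length sumDist-refl
                (sumDist-Lipschitzˡ (IsDist⇒Lipschitzˡ φ-dist) (IsDist⇒Lipschitzˡ ψ-dist)) p
    where
    sumDist-refl : ∀ u → sumDist φ ψ u u ≡ 0
    sumDist-refl (g , h) = cong₂ _+_ (IsDist⇒refl φ-dist g) (IsDist⇒refl ψ-dist h)

d≰1+m∸d⇒0<m : ∀ {m d} → d ≤ m → ¬ (d ≤ suc m ∸ d) → 0 < m
d≰1+m∸d⇒0<m {zero}  z≤n 0≰1 = contradiction z≤n 0≰1
d≰1+m∸d⇒0<m {suc m} _   _   = z<s

module CycleGraph (m : ℕ) where

  n : ℕ
  n = suc m

  dist : Fin n → Fin n → ℕ
  dist x y = cycleDist n (toℕ x) (toℕ y)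

  toℕ≤m : (x : Fin n) → toℕ x ≤ m
  toℕ≤m x = s≤s⁻¹ (toℕ<n x)

  adj-sym : ∀ {x y} → Adj (Cycle n) x y → Adj (Cycle n) y x
  adj-sym (x≢y , e) = x≢y ∘ sym , Sum.swap e

  suc-adj : ∀ {x y} → toℕ y ≡ suc (toℕ x) → Adj (Cycle n) x y
  suc-adj {x} {y} y≡1+x =
      (λ x≡y → 1+n≢n (trans (sym y≡1+x) (cong toℕ (sym x≡y))))
    , inj₂ (trans y≡1+x (sym ([a+1]%[1+m]≡1+a (s≤s⁻¹ (subst (_< n) y≡1+x (toℕ<n y))))))

  last-adj : 0 < m → Adj (Cycle n) (fromℕ m) Fin.zero
  last-adj 0<m =
      (λ last≡0 → <⇒≢ 0<m (sym (trans (sym (toℕ-fromℕ m)) (cong toℕ last≡0))))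
    , inj₂ (sym (trans (cong (λ t → (t + 1) % n) (toℕ-fromℕ m)) ([m+1]%[1+m]≡0 m)))

  up : ∀ d {x y} → toℕ x + d ≡ toℕ y → Walk (Cycle n) x y d
  up zero    {x} {y} x+0≡y =
    subst (λ z → Walk _ x z 0) (toℕ-injective (trans (sym (+-identityʳ _)) x+0≡y)) nil
  up (suc d) {x} {y} x+1+d≡y =
    cons (suc-adj (toℕ-fromℕ< 1+x<n))
         (up d (trans (cong (_+ d) (toℕ-fromℕ< 1+x<n)) (trans (sym (+-suc (toℕ x) d)) x+1+d≡y)))
    where
    1+x<n : suc (toℕ x) < n
    1+x<n = ≤-<-trans (≤-trans (s≤s (m≤m+n (toℕ x) d))
                               (≤-reflexive (trans (sym (+-suc (toℕ x) d)) x+1+d≡y)))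
                      (toℕ<n y)

  -- The short arc from x up to y, or else the arc from y up to the last vertex, across the
  -- edge back to 0 and up to x, traversed backwards.
  walk-≤ : ∀ {x y} → toℕ x ≤ toℕ y → Walk (Cycle n) x y (dist x y)
  walk-≤ {x} {y} x≤y rewrite m≤n⇒∣m-n∣≡n∸m x≤y with (toℕ y ∸ toℕ x) ≤? (n ∸ (toℕ y ∸ toℕ x))
  ... | yes short = subst (Walk _ x y) (sym (m≤n⇒m⊓n≡m short)) (up _ (m+[n∸m]≡n x≤y))
  ... | no long   =
    subst (Walk _ x y)
          (trans ([m∸y]+[1+x]≡1+m∸[y∸x] x≤y (toℕ≤m y)) (sym (m≥n⇒m⊓n≡n (<⇒≤ (≰⇒> long)))))
          (reverseʷ adj-sym
            (up (m ∸ toℕ y) (trans (m+[n∸m]≡n (toℕ≤m y)) (sym (toℕ-fromℕ m)))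
             ++ʷ cons (last-adj (d≰1+m∸d⇒0<m (≤-trans (m∸n≤m (toℕ y) (toℕ x)) (toℕ≤m y)) long))
                      (up (toℕ x) {Fin.zero} refl)))

  walk : ∀ x y → Walk (Cycle n) x y (dist x y)
  walk x y with ≤-total (toℕ x) (toℕ y)
  ... | inj₁ x≤y = walk-≤ x≤y
  ... | inj₂ y≤x =
    subst (Walk _ x y) (cycleDist-comm n (toℕ y) (toℕ x)) (reverseʷ adj-sym (walk-≤ y≤x))

  dist-refl : ∀ x → dist x x ≡ 0
  dist-refl x = cong (minArc n) (∣n-n∣≡0 (toℕ x))

  dist-Lipschitzˡ : Lipschitzˡ (Cycle n) dist
  dist-Lipschitzˡ {x} {y} z (_ , inj₁ x≡[y+1]%n) =
    proj₁ (cycleDist-step (toℕ≤m y) (toℕ≤m z) x≡[y+1]%n)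
  dist-Lipschitzˡ {x} {y} z (_ , inj₂ y≡[x+1]%n) =
    proj₂ (cycleDist-step (toℕ≤m x) (toℕ≤m z) y≡[x+1]%n)

  dist-IsDist : ∀ x y → IsDist (Cycle n) x y (dist x y)
  dist-IsDist x y = walk x y , λ l p → Lipschitzˡ⇒≤length dist-refl dist-Lipschitzˡ p

module OddTorus (k : ℕ) where

  open CycleGraph (k + k)

  Torus : Graph
  Torus = Cycle n □ Cycle n

  torusDist : V Torus → V Torus → ℕ
  torusDist = sumDist {G = Cycle n} {H = Cycle n} dist dist

  torusDist-IsDist : ∀ u v → IsDist Torus u v (torusDist u v)
  torusDist-IsDist = □-IsDist dist-IsDist dist-IsDist

  dist≤k : ∀ x y → dist x y ≤ k
  dist≤k x y = minArc-odd-≤ k ∣ toℕ x - toℕ y ∣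

  torus-IsDiam : IsDiam Torus (k + k)
  torus-IsDiam =
      (λ u v → torusDist u v , torusDist-IsDist u v , torusDist≤2k u v)
    , origin , antipode
    , subst (IsDist Torus origin antipode) (cong₂ _+_ dist0k dist0k)
            (torusDist-IsDist origin antipode)
    where
    torusDist≤2k : ∀ u v → torusDist u v ≤ k + k
    torusDist≤2k (x₁ , x₂) (y₁ , y₂) = +-mono-≤ (dist≤k x₁ y₁) (dist≤k x₂ y₂)
    half : Fin n
    half = fromℕ< (s≤s (m≤m+n k k))
    origin antipode : V Torus
    origin   = Fin.zero , Fin.zero
    antipode = half , half
    dist0k : dist Fin.zero half ≡ k
    dist0k = trans (cong (minArc n) (toℕ-fromℕ< _)) (minArc-odd-half k)

  torus-perimeter : ∀ u v w → torusDist u v + torusDist v w + torusDist u w ≤ n + n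
  torus-perimeter (x₁ , x₂) (y₁ , y₂) (z₁ , z₂) = begin
    torusDist (x₁ , x₂) (y₁ , y₂) + torusDist (y₁ , y₂) (z₁ , z₂) + torusDist (x₁ , x₂) (z₁ , z₂)
      ≡⟨ rearrange (dist x₁ y₁) (dist x₂ y₂) (dist y₁ z₁) (dist y₂ z₂) (dist x₁ z₁) (dist x₂ z₂) ⟩
    perimeter n (toℕ x₁) (toℕ y₁) (toℕ z₁) + perimeter n (toℕ x₂) (toℕ y₂) (toℕ z₂)
      ≤⟨ +-mono-≤ (perimeter-≤ (bound x₁) (bound y₁) (bound z₁))
                  (perimeter-≤ (bound x₂) (bound y₂) (bound z₂)) ⟩
    n + n ∎
    where
    open ≤-Reasoning
    bound : (x : Fin n) → toℕ x ≤ n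
    bound x = <⇒≤ (toℕ<n x)
    rearrange = solve 6 (λ a₁ a₂ b₁ b₂ c₁ c₂ →
      (a₁ :+ a₂) :+ (b₁ :+ b₂) :+ (c₁ :+ c₂) := (a₁ :+ b₁ :+ c₁) :+ (a₂ :+ b₂ :+ c₂)) refl

  radio-span : ∀ c → IsRadioLabeling Torus c →
               ∀ u v w → c u < c v → c v < c w → k + 1 ≤ c w ∸ c u
  radio-span c radio u v w cu<cv cv<cw =
    1+2k≤2t⇒k+1≤t (three-gaps {d₁ = torusDist u v} {torusDist v w} {torusDist u w}
                              ([n∸m]+[o∸n]≡o∸m (<⇒≤ cu<cv) (<⇒≤ cv<cw))
                              (gap cu<cv) (gap cv<cw) (gap (<-trans cu<cv cv<cw))
                              (torus-perimeter u v w))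
    where
    gap : ∀ {x y} → c x < c y → n ≤ torusDist x y + (c y ∸ c x)
    gap {x} {y} = radio-gap radio torus-IsDiam (torusDist-IsDist x y)

lemma2p5 : (k : ℕ) (c : V (Cycle (2 * k + 1) □ Cycle (2 * k + 1)) → ℕ) →
    IsRadioLabeling (Cycle (2 * k + 1) □ Cycle (2 * k + 1)) c →
    ∀ u v w → c u < c v → c v < c w → k + 1 ≤ c w ∸ c u
lemma2p5 k rewrite 2*k+1≡1+[k+k] k = OddTorus.radio-span k
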